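{- Let $X$ be a graph and let $U$ be a convex subgraph of $X$ to which $X$ projects, with projection map $\pi$. Then for each vertex $u$ of $U$, \[ w_U(u) = \sum_{x\in\pi^{ -1}(u)} q^{d(u,x)} w_X(x). \]
   Context: A graph means a finite undirected graph with no loops or multiple edges; it may be disconnected. For vertices $x,y$ of a graph $G$, $d_G(x,y)$ is the length of a shortest path from $x$ to $y$ in $G$, or $\infty$ if there is none; by convention $q^\infty=0$. Let $Z_G(q)$ be the square matrix over $\mathbb{Z}[q]$, indexed by the vertices of $G$, with $(x,y)$-entry $q^{d_G(x,y)}$. It is invertible over $\mathbb{Q}(q)$. The weighting of $G$ is $w_G(x)=\sum_{y\in G}Z_G(q)^{ -1}(x,y)\in\mathbb{Q}(q)$ for $x\in G$. A subgraph $U$ of $X$ is convex if $d_U(u,u')=d_X(u,u')$ for all vertices $u,u'$ of $U$; we then write $d$ for this common distance. For convex $U$, let $X_U$ be the set of vertices of $X$ joined by a path to some vertex of $U$. We say $X$ projects to $U$ if for every $x\in X_U$ there is a vertex $\pi(x)\in U$ with $d(x,u)=d(x,\pi(x))+d(\pi(x),u)$ for all vertices $u\in U$. Such a $\pi(x)$ is unique (it is the vertex of $U$ closest to $x$), and this defines the projection $\pi\colon X_U\to V(U)$. -}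

module Defs where

open import Data.Bool using (Bool; true; false; if_then_else_; _∧_; _∨_; T)
open import Data.Nat using (ℕ; zero; suc) renaming (_+_ to _+ℕ_)
open import Data.Fin using (Fin; zero; suc) renaming (_≟_ to _≟F_)
open import Data.List using (List; []; _∷_; map; replicate; _++_)
open import Data.List.Relation.Unary.All using (All)
open import Data.Maybe using (Maybe; just; nothing; is-just)
open import Data.Product using (_×_; _,_; proj₁; proj₂)
open import Data.Rational using (ℚ; 0ℚ; 1ℚ) renaming (_+_ to _+ℚ_; _*_ to _*ℚ_; -_ to -ℚ_)
open import Relation.Binary.PropositionalEquality using (_≡_)
open import Relation.Nullary using (¬_; does)
open import Function using (Injective)

-- Extended naturals ℕ ∪ {∞}: nothing = ∞

ℕ∞ : Set
ℕ∞ = Maybe ℕ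

_+∞_ : ℕ∞ → ℕ∞ → ℕ∞
just a +∞ just b = just (a +ℕ b)
_ +∞ _ = nothing

record Graph (n : ℕ) : Set where
  field
    adj    : Fin n → Fin n → Bool
    sym    : ∀ x y → adj x y ≡ adj y x
    irrefl : ∀ x → adj x x ≡ false
open Graph public

anyFin : (n : ℕ) → (Fin n → Bool) → Bool
anyFin zero    f = false
anyFin (suc n) f = f zero ∨ anyFin n (λ i → f (suc i))

_==F_ : {n : ℕ} → Fin n → Fin n → Bool
x ==F y = does (x ≟F y)

walk : {n : ℕ} → Graph n → ℕ → Fin n → Fin n → Bool
walk {n} G zero    x y = x ==F y
walk {n} G (suc k) x y = anyFin n (λ z → adj G x z ∧ walk G k z y)

searchDist : {n : ℕ} → Graph n → Fin n → Fin n → (fuel start : ℕ) → ℕ∞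
searchDist G x y fuel start with walk G start x y
... | true = just start
searchDist G x y zero       start | false = nothing
searchDist G x y (suc fuel) start | false = searchDist G x y fuel (suc start)

-- d_G(x,y): length of a shortest path (= least length of a walk; any
-- shortest path has length < n), or ∞ if x and y are not connected.
dist : {n : ℕ} → Graph n → Fin n → Fin n → ℕ∞
dist {n} G x y = searchDist G x y n 0

-- ℚ[q] as coefficient lists (lowest degree first) and ℚ(q) as fractions

Poly : Set
Poly = List ℚ

addP : Poly → Poly → Poly
addP []       ys       = ys
addP (x ∷ xs) []       = x ∷ xs
addP (x ∷ xs) (y ∷ ys) = (x +ℚ y) ∷ addP xs ys

scaleP : ℚ → Poly → Poly
scaleP c = map (c *ℚ_)

mulP : Poly → Poly → Poly
mulP []       ys = []
mulP (x ∷ xs) ys = addP (scaleP x ys) (0ℚ ∷ mulP xs ys)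

negP : Poly → Poly
negP = map -ℚ_

IsZeroP : Poly → Set
IsZeroP p = All (_≡ 0ℚ) p

_≈P_ : Poly → Poly → Set
p ≈P r = IsZeroP (addP p (negP r))

monoP : ℕ → Poly
monoP k = replicate k 0ℚ ++ (1ℚ ∷ [])

Frac : Set
Frac = Poly × Poly

ValidF : Frac → Set
ValidF f = ¬ IsZeroP (proj₂ f)

_≈F_ : Frac → Frac → Set
(a , b) ≈F (c , d) = mulP a d ≈P mulP c b

_+F_ : Frac → Frac → Frac
(a , b) +F (c , d) = (addP (mulP a d) (mulP c b) , mulP b d)

_*F_ : Frac → Frac → Frac
(a , b) *F (c , d) = (mulP a c , mulP b d)

0F : Frac
0F = ([] , 1ℚ ∷ [])

1F : Frac
1F = (1ℚ ∷ [] , 1ℚ ∷ [])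

-- q^d with q^∞ = 0
qpow : ℕ∞ → Frac
qpow nothing  = 0F
qpow (just k) = (monoP k , 1ℚ ∷ [])

sumF : (n : ℕ) → (Fin n → Frac) → Frac
sumF zero    f = 0F
sumF (suc n) f = f zero +F sumF n (λ i → f (suc i))

Mat : ℕ → Set
Mat n = Fin n → Fin n → Frac

_·M_ : {n : ℕ} → Mat n → Mat n → Mat n
_·M_ {n} A B i j = sumF n (λ k → A i k *F B k j)

idM : {n : ℕ} → Mat n
idM i j = if i ==F j then 1F else 0F

Zmat : {n : ℕ} → Graph n → Mat n
Zmat G x y = qpow (dist G x y)

IsInverse : {n : ℕ} → Mat n → Mat n → Set
IsInverse M A = (∀ i j → ValidF (M i j))
              × (∀ i j → (M ·M A) i j ≈F idM i j)
              × (∀ i j → (A ·M M) i j ≈F idM i j)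

-- weighting computed from the inverse M of Z_G(q): w(x) = Σ_y M(x,y)
weighting : {n : ℕ} → Mat n → Fin n → Frac
weighting {n} M x = sumF n (λ y → M x y)

record IsSubgraph {m n : ℕ} (U : Graph m) (X : Graph n) (ι : Fin m → Fin n) : Set where
  field
    inj   : Injective _≡_ _≡_ ι
    edges : ∀ a b → T (adj U a b) → T (adj X (ι a) (ι b))

IsConvex : {m n : ℕ} (U : Graph m) (X : Graph n) (ι : Fin m → Fin n) → Set
IsConvex U X ι = IsSubgraph U X ι × (∀ a b → dist U a b ≡ dist X (ι a) (ι b))

inXU : {m n : ℕ} (X : Graph n) (ι : Fin m → Fin n) → Fin n → Bool
inXU {m} X ι x = anyFin m (λ u → is-just (dist X x (ι u)))

-- π is a projection of X onto U (its values outside X_U are irrelevant)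
IsProjection : {m n : ℕ} (X : Graph n) (ι : Fin m → Fin n) → (Fin n → Fin m) → Set
IsProjection X ι π =
  ∀ x → T (inXU X ι x) →
    ∀ u → dist X x (ι u) ≡ (dist X x (ι (π x)) +∞ dist X (ι (π x)) (ι u))

fiberSum : {m n : ℕ} (X : Graph n) (ι : Fin m → Fin n) (π : Fin n → Fin m)
           (wX : Fin n → Frac) (u : Fin m) → Frac
fiberSum {m} {n} X ι π wX u =
  sumF n (λ x → if inXU X ι x ∧ (π x ==F u)
                then qpow (dist X (ι u) x) *F wX x
                else 0F)

module Submission where

-- The paper's argument is linear algebra over ℚ(q): the vector f(u) of fibre sums
-- satisfies  Z_U f = 𝟙,  because summing the fibres against Z_U reassembles the rows
-- Z_X w_X = 𝟙  (a path from u' ∈ U to x ∈ X_U factors through π x, and vertices outside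
-- X_U are at distance ∞ from U); as Z_U is invertible, f = Z_U⁻¹ 𝟙 = w_U.
--
-- Here ℚ(q) consists of raw fraction pairs of coefficient lists, so instead of doing the
-- algebra in ℚ(q) we evaluate at rational points q = t.

open import Defs hiding (sym)
open import Level using (0ℓ)
open import Algebra.Bundles using (Semiring; CommutativeSemiring; CommutativeRing)
open import Data.Bool using (Bool; true; false; if_then_else_; _∧_; _∨_; T)
open import Data.Bool.Properties
  using (∨-∧-commutativeSemiring; ∧-comm; ∧-assoc; ∨-conicalˡ; ∨-conicalʳ)
open import Data.Empty using (⊥-elim)
open import Data.Fin using (Fin; zero; suc)
import Data.Integer as ℤ
open import Data.Integer.Properties using (+-injective)
open import Data.List using (List; []; _∷_; length; filter; map; upTo; concat; tabulate; _++_)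
open import Data.List.Properties using (length-map; length-applyUpTo)
open import Data.List.Relation.Unary.All using (All; []; _∷_; zipWith; universal)
  renaming (map to All-map)
open import Data.List.Relation.Unary.All.Properties
  using (all-filter; filter⁺; concat⁺; concat⁻; ++⁺; ++⁻ˡ; ++⁻ʳ)
  renaming (tabulate⁺ to All-tabulate⁺; tabulate⁻ to All-tabulate⁻)
open import Data.List.Relation.Unary.AllPairs using ([]; _∷_)
open import Data.List.Relation.Unary.Unique.Propositional using (Unique)
import Data.List.Relation.Unary.Unique.Propositional.Properties as Unique
open import Data.Maybe using (just; nothing; is-just)
open import Data.Nat using (ℕ; zero; suc; _≤_; _≤?_; z≤n; s≤s) renaming (_+_ to _+ℕ_)
open import Data.Nat.Properties
  using (≤-trans; ≤-reflexive; <⇒≤; ≰⇒>; +-mono-≤; +-cancelʳ-≤; +-commutativeSemigroup;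
         module ≤-Reasoning)
  renaming (+-comm to +ℕ-comm; +-identityʳ to +ℕ-identityʳ)
open import Algebra.Properties.CommutativeSemigroup +-commutativeSemigroup using (x∙yz≈y∙xz)
open import Data.Product using (∃; _,_; proj₁; proj₂)
open import Data.Rational using (ℚ; 0ℚ; 1ℚ; _+_; _*_; -_; 1/_; ↥_)
open import Data.Rational.Base using (≢-nonZero)
open import Data.Rational.Literals using (fromℤ)
open import Data.Rational.Properties
  using ( _≟_; +-*-commutativeRing; heytingCommutativeRing; +-0-group
        ; +-identityˡ; +-identityʳ; *-identityˡ; *-identityʳ; *-zeroˡ; *-zeroʳ
        ; *-assoc; *-inverseˡ; *-inverseʳ)
open import Algebra.Apartness.Properties.HeytingCommutativeRing heytingCommutativeRing
  using (x#0y#0→xy#0)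
open import Algebra.Properties.Group +-0-group using (x∙y⁻¹≈ε⇒x≈y)
open import Data.Rational.Solver using (module +-*-Solver)
open import Data.Unit using (tt)
open import Relation.Nullary using (¬_; yes; no; does)
open import Relation.Unary using (Decidable)
open import Relation.Unary.Properties using (∁?)
open import Relation.Binary.PropositionalEquality
  using (_≡_; _≢_; refl; sym; trans; cong; cong₂; subst; module ≡-Reasoning)

open +-*-Solver

module FinSums {c ℓ} (R : Semiring c ℓ) where

  private module R = Semiring R
  open import Algebra.Properties.Semiring.Sum R public

  sum-selectˡ : ∀ {n} (i : Fin n) (f : Fin n → R.Carrier) →
                R._≈_ (sum (λ k → if i ==F k then f k else R.0#)) (f i)
  sum-selectˡ {suc n} zero    f =
    R.trans (R.+-congˡ (sum-replicate-zero n)) (R.+-identityʳ (f zero))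
  sum-selectˡ {suc n} (suc i) f = R.trans (R.+-identityˡ _) (sum-selectˡ i (λ k → f (suc k)))

  sum-selectʳ : ∀ {n} (i : Fin n) (f : Fin n → R.Carrier) →
                R._≈_ (sum (λ k → if k ==F i then f k else R.0#)) (f i)
  sum-selectʳ {suc n} zero    f =
    R.trans (R.+-congˡ (sum-replicate-zero n)) (R.+-identityʳ (f zero))
  sum-selectʳ {suc n} (suc i) f = R.trans (R.+-identityˡ _) (sum-selectʳ i (λ k → f (suc k)))

module 𝔹 = FinSums (CommutativeSemiring.semiring ∨-∧-commutativeSemiring)

anyFin-sum : ∀ n (f : Fin n → Bool) → anyFin n f ≡ 𝔹.sum f
anyFin-sum zero    f = refl
anyFin-sum (suc n) f = cong (f zero ∨_) (anyFin-sum n (λ i → f (suc i)))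

anyFin-false : ∀ n (f : Fin n → Bool) → anyFin n f ≡ false → ∀ i → f i ≡ false
anyFin-false (suc n) f e zero    = ∨-conicalˡ _ _ e
anyFin-false (suc n) f e (suc i) = anyFin-false n (λ k → f (suc k)) (∨-conicalʳ _ _ e) i

∧-as-if : ∀ b c → b ∧ c ≡ (if b then c else false)
∧-as-if true  c = refl
∧-as-if false c = refl

==F-sym : ∀ {n} (i j : Fin n) → (i ==F j) ≡ (j ==F i)
==F-sym zero    zero    = refl
==F-sym zero    (suc j) = refl
==F-sym (suc i) zero    = refl
==F-sym (suc i) (suc j) = ==F-sym i j

module _ {n : ℕ} (G : Graph n) where

  ⋁ : (Fin n → Bool) → Bool
  ⋁ = 𝔹.sum

  walk-cons : ∀ k x y → walk G (suc k) x y ≡ ⋁ (λ z → adj G x z ∧ walk G k z y)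
  walk-cons k x y = anyFin-sum n _

  walk-snoc : ∀ k x y → walk G (suc k) x y ≡ ⋁ (λ z → walk G k x z ∧ adj G z y)
  walk-snoc zero x y = begin
      anyFin n (λ z → adj G x z ∧ (z ==F y))
    ≡⟨ anyFin-sum n _ ⟩
      ⋁ (λ z → adj G x z ∧ (z ==F y))
    ≡⟨ 𝔹.sum-cong-≗ {n} (λ z → trans (∧-comm (adj G x z) _) (∧-as-if (z ==F y) _)) ⟩
      ⋁ (λ z → if z ==F y then adj G x z else false)
    ≡⟨ 𝔹.sum-selectʳ y (adj G x) ⟩
      adj G x y
    ≡⟨ sym (𝔹.sum-selectˡ x (λ z → adj G z y)) ⟩
      ⋁ (λ z → if x ==F z then adj G z y else false)
    ≡⟨ 𝔹.sum-cong-≗ {n} (λ z → sym (∧-as-if (x ==F z) _)) ⟩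
      ⋁ (λ z → (x ==F z) ∧ adj G z y) ∎
    where open ≡-Reasoning
  walk-snoc (suc k) x y = begin
      walk G (suc (suc k)) x y
    ≡⟨ walk-cons (suc k) x y ⟩
      ⋁ (λ z → adj G x z ∧ walk G (suc k) z y)
    ≡⟨ 𝔹.sum-cong-≗ {n} (λ z → cong (adj G x z ∧_) (walk-snoc k z y)) ⟩
      ⋁ (λ z → adj G x z ∧ ⋁ (λ w → walk G k z w ∧ adj G w y))
    ≡⟨ 𝔹.sum-cong-≗ {n} (λ z → 𝔹.*-distribˡ-sum {n} (adj G x z) _) ⟩
      ⋁ (λ z → ⋁ (λ w → adj G x z ∧ (walk G k z w ∧ adj G w y)))
    ≡⟨ 𝔹.∑-comm {n} {n} _ ⟩
      ⋁ (λ w → ⋁ (λ z → adj G x z ∧ (walk G k z w ∧ adj G w y)))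
    ≡⟨ 𝔹.sum-cong-≗ {n} (λ w → 𝔹.sum-cong-≗ {n} (λ z →
                          sym (∧-assoc (adj G x z) _ _))) ⟩
      ⋁ (λ w → ⋁ (λ z → (adj G x z ∧ walk G k z w) ∧ adj G w y))
    ≡⟨ 𝔹.sum-cong-≗ {n} (λ w → sym (𝔹.*-distribʳ-sum {n} (adj G w y) _)) ⟩
      ⋁ (λ w → ⋁ (λ z → adj G x z ∧ walk G k z w) ∧ adj G w y)
    ≡⟨ 𝔹.sum-cong-≗ {n} (λ w → cong (_∧ adj G w y) (sym (walk-cons k x w))) ⟩
      ⋁ (λ w → walk G (suc k) x w ∧ adj G w y) ∎
    where open ≡-Reasoning

  walk-sym : ∀ k x y → walk G k x y ≡ walk G k y x
  walk-sym zero    x y = ==F-sym x y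
  walk-sym (suc k) x y = begin
      walk G (suc k) x y
    ≡⟨ walk-cons k x y ⟩
      ⋁ (λ z → adj G x z ∧ walk G k z y)
    ≡⟨ 𝔹.sum-cong-≗ {n} (λ z → trans (∧-comm (adj G x z) _)
                                  (cong₂ _∧_ (walk-sym k z y) (Graph.sym G x z))) ⟩
      ⋁ (λ z → walk G k y z ∧ adj G z x)
    ≡⟨ sym (walk-snoc k y x) ⟩
      walk G (suc k) y x ∎
    where open ≡-Reasoning

  dist-sym : ∀ x y → dist G x y ≡ dist G y x
  dist-sym x y = search-sym n 0
    where
    search-sym : ∀ fuel start → searchDist G x y fuel start ≡ searchDist G y x fuel start
    search-sym fuel start with walk G start x y | walk G start y x | walk-sym start x y
    ... | true  | true  | _ = refl
    search-sym zero       start | false | false | _ = refl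
    search-sym (suc fuel) start | false | false | _ = search-sym fuel (suc start)

+∞-comm : ∀ a b → a +∞ b ≡ b +∞ a
+∞-comm (just a) (just b) = cong just (+ℕ-comm a b)
+∞-comm (just a) nothing  = refl
+∞-comm nothing  (just b) = refl
+∞-comm nothing  nothing  = refl

projection-factorises : ∀ {m n} {X : Graph n} {U : Graph m}
                          {ι : Fin m → Fin n} {π : Fin n → Fin m} →
  IsConvex U X ι → IsProjection X ι π →
  ∀ u' x → T (inXU X ι x) → dist X (ι u') x ≡ dist U u' (π x) +∞ dist X (ι (π x)) x
projection-factorises {X = X} {U} {ι} {π} (_ , convex) projects u' x x∈XU = begin
    dist X (ι u') x
  ≡⟨ dist-sym X (ι u') x ⟩
    dist X x (ι u')
  ≡⟨ projects x x∈XU u' ⟩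
    dist X x (ι (π x)) +∞ dist X (ι (π x)) (ι u')
  ≡⟨ +∞-comm (dist X x (ι (π x))) _ ⟩
    dist X (ι (π x)) (ι u') +∞ dist X x (ι (π x))
  ≡⟨ cong₂ _+∞_ (trans (dist-sym X (ι (π x)) (ι u')) (sym (convex u' (π x))))
                (dist-sym X x (ι (π x))) ⟩
    dist U u' (π x) +∞ dist X (ι (π x)) x ∎
  where open ≡-Reasoning

outside-unreachable : ∀ {m n} {X : Graph n} {ι : Fin m → Fin n} u' x →
                      inXU X ι x ≡ false → dist X (ι u') x ≡ nothing
outside-unreachable {m} {X = X} {ι} u' x x∉XU
  with dist X x (ι u') | dist-sym X x (ι u')
     | anyFin-false m (λ u → is-just (dist X x (ι u))) x∉XU u'
... | nothing | d≡ | _ = sym d≡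

ℚ-semiring : Semiring 0ℓ 0ℓ
ℚ-semiring = CommutativeRing.semiring +-*-commutativeRing

open FinSums ℚ-semiring
open import Algebra.Properties.Semiring.Exp ℚ-semiring using (_^_; ^-homo-*)

*-cancelʳ-≢0 : ∀ {x y b} → b ≢ 0ℚ → x * b ≡ y * b → x ≡ y
*-cancelʳ-≢0 {x} {y} {b} b≢0 xb≡yb = begin
    x                  ≡⟨ sym (divide-out x) ⟩
    x * b * (1/ b)     ≡⟨ cong (_* (1/ b)) xb≡yb ⟩
    y * b * (1/ b)     ≡⟨ divide-out y ⟩
    y                  ∎
  where
  open ≡-Reasoning
  instance _ = ≢-nonZero b≢0
  divide-out : ∀ z → z * b * (1/ b) ≡ z
  divide-out z = trans (*-assoc z b (1/ b)) (trans (cong (z *_) (*-inverseʳ b)) (*-identityʳ z))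

eval : Poly → ℚ → ℚ
eval []      t = 0ℚ
eval (c ∷ p) t = c + t * eval p t

eval-constant : ∀ c t → eval (c ∷ []) t ≡ c
eval-constant c t = trans (cong (c +_) (*-zeroʳ t)) (+-identityʳ c)

eval-addP : ∀ p r t → eval (addP p r) t ≡ eval p t + eval r t
eval-addP []      r       t = sym (+-identityˡ _)
eval-addP (c ∷ p) []      t = sym (+-identityʳ _)
eval-addP (c ∷ p) (d ∷ r) t = begin
    (c + d) + t * eval (addP p r) t
  ≡⟨ cong (λ z → (c + d) + t * z) (eval-addP p r t) ⟩
    (c + d) + t * (eval p t + eval r t)
  ≡⟨ solve 5 (λ c d t a b → (c :+ d) :+ t :* (a :+ b) := (c :+ t :* a) :+ (d :+ t :* b))
           refl c d t (eval p t) (eval r t) ⟩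
    (c + t * eval p t) + (d + t * eval r t) ∎
  where open ≡-Reasoning

eval-scaleP : ∀ a p t → eval (scaleP a p) t ≡ a * eval p t
eval-scaleP a []      t = sym (*-zeroʳ a)
eval-scaleP a (c ∷ p) t = begin
    a * c + t * eval (scaleP a p) t
  ≡⟨ cong (λ z → a * c + t * z) (eval-scaleP a p t) ⟩
    a * c + t * (a * eval p t)
  ≡⟨ solve 4 (λ a c t e → a :* c :+ t :* (a :* e) := a :* (c :+ t :* e)) refl a c t (eval p t) ⟩
    a * (c + t * eval p t) ∎
  where open ≡-Reasoning

eval-mulP : ∀ p r t → eval (mulP p r) t ≡ eval p t * eval r t
eval-mulP []      r t = sym (*-zeroˡ (eval r t))
eval-mulP (c ∷ p) r t = begin
    eval (addP (scaleP c r) (0ℚ ∷ mulP p r)) t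
  ≡⟨ eval-addP (scaleP c r) _ t ⟩
    eval (scaleP c r) t + (0ℚ + t * eval (mulP p r) t)
  ≡⟨ cong₂ (λ a b → a + (0ℚ + t * b)) (eval-scaleP c r t) (eval-mulP p r t) ⟩
    c * eval r t + (0ℚ + t * (eval p t * eval r t))
  ≡⟨ solve 4 (λ c t a b → c :* b :+ (con 0ℚ :+ t :* (a :* b)) := (c :+ t :* a) :* b)
           refl c t (eval p t) (eval r t) ⟩
    (c + t * eval p t) * eval r t ∎
  where open ≡-Reasoning

eval-negP : ∀ p t → eval (negP p) t ≡ - eval p t
eval-negP []      t = refl
eval-negP (c ∷ p) t = begin
    - c + t * eval (negP p) t  ≡⟨ cong (λ z → - c + t * z) (eval-negP p t) ⟩
    - c + t * (- eval p t)     ≡⟨ solve 3 (λ c t e → :- c :+ t :* (:- e) := :- (c :+ t :* e))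
                                        refl c t (eval p t) ⟩
    - (c + t * eval p t)       ∎
  where open ≡-Reasoning

eval-monoP : ∀ k t → eval (monoP k) t ≡ t ^ k
eval-monoP zero    t = eval-constant 1ℚ t
eval-monoP (suc k) t = trans (+-identityˡ _) (cong (t *_) (eval-monoP k t))

eval-zero : ∀ p t → IsZeroP p → eval p t ≡ 0ℚ
eval-zero []      t []           = refl
eval-zero (c ∷ p) t (refl ∷ p≈0) =
  trans (cong (λ z → 0ℚ + t * z) (eval-zero p t p≈0)) (trans (+-identityˡ _) (*-zeroʳ t))

-- The polynomial whose vanishing is  f ≈F g :  num f · den g − num g · den f.
crossDiff : Frac → Frac → Poly
crossDiff f g = addP (mulP (proj₁ f) (proj₂ g)) (negP (mulP (proj₁ g) (proj₂ f)))

eval-crossDiff : ∀ f g t → eval (crossDiff f g) t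
               ≡ eval (proj₁ f) t * eval (proj₂ g) t + - (eval (proj₁ g) t * eval (proj₂ f) t)
eval-crossDiff (a , b) (c , d) t =
  trans (eval-addP (mulP a d) _ t)
        (cong₂ _+_ (eval-mulP a d t) (trans (eval-negP (mulP c b) t) (cong -_ (eval-mulP c b t))))

qval : ℚ → ℕ∞ → ℚ
qval t nothing  = 0ℚ
qval t (just k) = t ^ k

qval-+∞ : ∀ t a b → qval t (a +∞ b) ≡ qval t a * qval t b
qval-+∞ t (just a) (just b) = ^-homo-* t a b
qval-+∞ t (just a) nothing  = sym (*-zeroʳ (t ^ a))
qval-+∞ t nothing  b        = sym (*-zeroˡ (qval t b))

δ : ∀ {n} → Fin n → Fin n → ℚ
δ i j = if i ==F j then 1ℚ else 0ℚ

record Value (t : ℚ) (f : Frac) (v : ℚ) : Set where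
  constructor value
  field
    den≢0 : eval (proj₂ f) t ≢ 0ℚ
    num≡  : eval (proj₁ f) t ≡ v * eval (proj₂ f) t

one≢0 : ∀ t → eval (1ℚ ∷ []) t ≢ 0ℚ
one≢0 t e with trans (sym (eval-constant 1ℚ t)) e
... | ()

value-exists : ∀ f t → eval (proj₂ f) t ≢ 0ℚ → ∃ (Value t f)
value-exists (a , b) t b≢0 = eval a t * (1/ eval b t) , value b≢0 (begin
    eval a t                                  ≡⟨ sym (*-identityʳ _) ⟩
    eval a t * 1ℚ                             ≡⟨ cong (eval a t *_) (sym (*-inverseˡ (eval b t))) ⟩
    eval a t * (1/ eval b t * eval b t)       ≡⟨ sym (*-assoc (eval a t) _ _) ⟩
    eval a t * (1/ eval b t) * eval b t       ∎)
  where open ≡-Reasoning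
        instance _ = ≢-nonZero b≢0

value-unique : ∀ {t f v w} → Value t f v → Value t f w → v ≡ w
value-unique (value b≢0 e₁) (value _ e₂) = *-cancelʳ-≢0 b≢0 (trans (sym e₁) e₂)

value-0F : ∀ t → Value t 0F 0ℚ
value-0F t = value (one≢0 t) (sym (*-zeroˡ (eval (1ℚ ∷ []) t)))

value-1F : ∀ t → Value t 1F 1ℚ
value-1F t = value (one≢0 t) (sym (*-identityˡ (eval (1ℚ ∷ []) t)))

value-qpow : ∀ t d → Value t (qpow d) (qval t d)
value-qpow t nothing  = value-0F t
value-qpow t (just k) = value (one≢0 t)
  (trans (eval-monoP k t) (sym (trans (cong (t ^ k *_) (eval-constant 1ℚ t)) (*-identityʳ _))))

value-if : ∀ {t f v} (b : Bool) → Value t f v → Value t (if b then f else 0F) (if b then v else 0ℚ)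
value-if     true  f≔v = f≔v
value-if {t} false _   = value-0F t

value-idM : ∀ {n} t (i j : Fin n) → Value t (idM i j) (δ i j)
value-idM t i j = value-if (i ==F j) (value-1F t)

value-+F : ∀ {t f g v w} → Value t f v → Value t g w → Value t (f +F g) (v + w)
value-+F {t} {a , b} {c , d} {v} {w} (value b≢0 a≡) (value d≢0 c≡) =
  value (λ bd≡0 → x#0y#0→xy#0 b≢0 d≢0 (trans (sym (eval-mulP b d t)) bd≡0)) (begin
    eval (addP (mulP a d) (mulP c b)) t      ≡⟨ eval-addP (mulP a d) _ t ⟩
    eval (mulP a d) t + eval (mulP c b) t    ≡⟨ cong₂ _+_ (eval-mulP a d t) (eval-mulP c b t) ⟩
    eval a t * eval d t + eval c t * eval b t
      ≡⟨ cong₂ (λ x y → x * eval d t + y * eval b t) a≡ c≡ ⟩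
    v * eval b t * eval d t + w * eval d t * eval b t
      ≡⟨ solve 4 (λ v w b d → v :* b :* d :+ w :* d :* b := (v :+ w) :* (b :* d))
               refl v w (eval b t) (eval d t) ⟩
    (v + w) * (eval b t * eval d t)          ≡⟨ cong ((v + w) *_) (sym (eval-mulP b d t)) ⟩
    (v + w) * eval (mulP b d) t              ∎)
  where open ≡-Reasoning

value-*F : ∀ {t f g v w} → Value t f v → Value t g w → Value t (f *F g) (v * w)
value-*F {t} {a , b} {c , d} {v} {w} (value b≢0 a≡) (value d≢0 c≡) =
  value (λ bd≡0 → x#0y#0→xy#0 b≢0 d≢0 (trans (sym (eval-mulP b d t)) bd≡0)) (begin
    eval (mulP a c) t                 ≡⟨ eval-mulP a c t ⟩
    eval a t * eval c t               ≡⟨ cong₂ _*_ a≡ c≡ ⟩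
    v * eval b t * (w * eval d t)
      ≡⟨ solve 4 (λ v w b d → v :* b :* (w :* d) := (v :* w) :* (b :* d))
               refl v w (eval b t) (eval d t) ⟩
    (v * w) * (eval b t * eval d t)   ≡⟨ cong ((v * w) *_) (sym (eval-mulP b d t)) ⟩
    (v * w) * eval (mulP b d) t       ∎)
  where open ≡-Reasoning

value-sumF : ∀ {t} n {F : Fin n → Frac} {v : Fin n → ℚ} →
             (∀ i → Value t (F i) (v i)) → Value t (sumF n F) (sum v)
value-sumF {t} zero    _   = value-0F t
value-sumF     (suc n) F≔v = value-+F (F≔v zero) (value-sumF n (λ i → F≔v (suc i)))

value-crossDiff : ∀ {t f g v} → Value t f v → Value t g v → eval (crossDiff f g) t ≡ 0ℚ
value-crossDiff {t} {a , b} {c , d} {v} (value _ a≡) (value _ c≡) = begin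
    eval (crossDiff (a , b) (c , d)) t
  ≡⟨ eval-crossDiff (a , b) (c , d) t ⟩
    eval a t * eval d t + - (eval c t * eval b t)
  ≡⟨ cong₂ (λ x y → x * eval d t + - (y * eval b t)) a≡ c≡ ⟩
    v * eval b t * eval d t + - (v * eval d t * eval b t)
  ≡⟨ solve 3 (λ v b d → v :* b :* d :+ :- (v :* d :* b) := con 0ℚ) refl v (eval b t) (eval d t) ⟩
    0ℚ ∎
  where open ≡-Reasoning

-- Values transport along f ≈F g (to a g defined at t): f ≈F g says that
-- crossDiff f g is the zero polynomial, so the cross products agree at t.
value-≈F : ∀ {t f g v} → Value t f v → f ≈F g → eval (proj₂ g) t ≢ 0ℚ → Value t g v
value-≈F {t} {a , b} {c , d} {v} (value b≢0 a≡) f≈g d≢0 = value d≢0 (*-cancelʳ-≢0 b≢0 (begin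
    eval c t * eval b t       ≡⟨ sym cross-products-agree ⟩
    eval a t * eval d t       ≡⟨ cong (_* eval d t) a≡ ⟩
    v * eval b t * eval d t   ≡⟨ solve 3 (λ v b d → v :* b :* d := v :* d :* b)
                                       refl v (eval b t) (eval d t) ⟩
    v * eval d t * eval b t   ∎))
  where
  open ≡-Reasoning
  cross-products-agree : eval a t * eval d t ≡ eval c t * eval b t
  cross-products-agree = x∙y⁻¹≈ε⇒x≈y _ _
    (trans (sym (eval-crossDiff (a , b) (c , d) t)) (eval-zero _ t f≈g))

-- Synthetic division by (X − a):  p = (X − a) · quotient a p + p(a).
quotient : ℚ → Poly → Poly
quotient a []          = []
quotient a (c ∷ [])    = []
quotient a (c ∷ d ∷ p) = eval (d ∷ p) a ∷ quotient a (d ∷ p)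

eval-quotient : ∀ a p x → eval p x ≡ (x + - a) * eval (quotient a p) x + eval p a
eval-quotient a []          x =
  solve 2 (λ x a → con 0ℚ := (x :+ :- a) :* con 0ℚ :+ con 0ℚ) refl x a
eval-quotient a (c ∷ [])    x =
  solve 3 (λ c x a → c :+ x :* con 0ℚ := (x :+ :- a) :* con 0ℚ :+ (c :+ a :* con 0ℚ)) refl c x a
eval-quotient a (c ∷ d ∷ p) x = begin
    c + x * eval (d ∷ p) x
  ≡⟨ cong (λ z → c + x * z) (eval-quotient a (d ∷ p) x) ⟩
    c + x * ((x + - a) * Q + P)
  ≡⟨ solve 5 (λ c x a Q P → c :+ x :* ((x :+ :- a) :* Q :+ P)
                           := (x :+ :- a) :* (P :+ x :* Q) :+ (c :+ a :* P))
           refl c x a Q P ⟩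
    (x + - a) * (P + x * Q) + (c + a * P) ∎
  where open ≡-Reasoning
        Q = eval (quotient a (d ∷ p)) x
        P = eval (d ∷ p) a

-- If a is a root of p and the quotient is zero, p is zero: the coefficients of p
-- are, from the top, the (zero) coefficients of the quotient and finally p(a).
quotient-zero : ∀ a p → IsZeroP (quotient a p) → eval p a ≡ 0ℚ → IsZeroP p
quotient-zero a []          _        _    = []
quotient-zero a (c ∷ [])    _        p[a] = trans (sym (eval-constant c a)) p[a] ∷ []
quotient-zero a (c ∷ d ∷ p) (q ∷ qs) p[a] =
  trans (sym (trans (cong (λ w → c + a * w) q) (eval-constant c a))) p[a]
  ∷ quotient-zero a (d ∷ p) qs q

quotient-length : ∀ a p k → length p ≤ suc k → length (quotient a p) ≤ k
quotient-length a []          k       _         = z≤n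
quotient-length a (c ∷ [])    k       _         = z≤n
quotient-length a (c ∷ d ∷ p) (suc k) (s≤s len) = s≤s (quotient-length a (d ∷ p) k len)

-- A polynomial with at most k coefficients that vanishes at k distinct points is zero:
-- divide out one root and recurse on the remaining points.
vanishing-at-distinct-points : ∀ p xs → Unique xs → length p ≤ length xs →
                               All (λ x → eval p x ≡ 0ℚ) xs → IsZeroP p
vanishing-at-distinct-points []      []       _            _   _ = []
vanishing-at-distinct-points p       (a ∷ xs) (a∉xs ∷ uxs) len (p[a] ∷ p[xs]) =
  quotient-zero a p (vanishing-at-distinct-points (quotient a p) xs uxs
                       (quotient-length a p (length xs) len) (quotient-roots a∉xs p[xs])) p[a]
  where
  quotient-roots : ∀ {ys} → All (a ≢_) ys → All (λ x → eval p x ≡ 0ℚ) ys →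
                   All (λ x → eval (quotient a p) x ≡ 0ℚ) ys
  quotient-roots []             []            = []
  quotient-roots {y ∷ _} (a≢y ∷ a≢ys) (p[y] ∷ p[ys]) = *-cancelʳ-≢0 y-a≢0 (begin
      Q * (y + - a)                  ≡⟨ solve 2 (λ Q s → Q :* s := s :* Q :+ con 0ℚ)
                                                 refl Q (y + - a) ⟩
      (y + - a) * Q + 0ℚ             ≡⟨ cong (λ r → (y + - a) * Q + r) (sym p[a]) ⟩
      (y + - a) * Q + eval p a       ≡⟨ sym (eval-quotient a p y) ⟩
      eval p y                       ≡⟨ p[y] ⟩
      0ℚ                             ≡⟨ sym (*-zeroˡ (y + - a)) ⟩
      0ℚ * (y + - a)                 ∎) ∷ quotient-roots a≢ys p[ys]
    where
    open ≡-Reasoning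
    Q = eval (quotient a p) y
    y-a≢0 : y + - a ≢ 0ℚ
    y-a≢0 e = a≢y (sym (trans (solve 2 (λ y a → y := (y :+ :- a) :+ a) refl y a)
                              (trans (cong (_+ a) e) (+-identityˡ a))))

root? : (d : Poly) → Decidable (λ t → eval d t ≡ 0ℚ)
root? d t = eval d t ≟ 0ℚ

roots-bound : ∀ d xs → ¬ IsZeroP d → Unique xs → length (filter (root? d) xs) ≤ length d
roots-bound d xs d≢0 uxs with length d ≤? length (filter (root? d) xs)
... | yes many = ⊥-elim (d≢0 (vanishing-at-distinct-points d _ (Unique.filter⁺ (root? d) uxs)
                                many (all-filter (root? d) xs)))
... | no  few  = <⇒≤ (≰⇒> few)

length-filter-split : {A : Set} {P : A → Set} (P? : Decidable P) (xs : List A) →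
                      length (filter P? xs) +ℕ length (filter (∁? P?) xs) ≡ length xs
length-filter-split P? []       = refl
length-filter-split P? (x ∷ xs) with does (P? x)
... | true  = cong suc (length-filter-split P? xs)
... | false = trans (+ℕ-comm (length (filter P? xs)) _)
                    (cong suc (trans (+ℕ-comm _ (length (filter P? xs))) (length-filter-split P? xs)))

avoiding : List Poly → List ℚ → List ℚ
avoiding []       S = S
avoiding (d ∷ ds) S = avoiding ds (filter (∁? (root? d)) S)

NonVanishingAt : List Poly → ℚ → Set
NonVanishingAt ds t = All (λ d → eval d t ≢ 0ℚ) ds

avoiding-⊆ : ∀ {Q : ℚ → Set} ds {S} → All Q S → All Q (avoiding ds S)
avoiding-⊆ []       QS = QS
avoiding-⊆ (d ∷ ds) QS = avoiding-⊆ ds (filter⁺ (∁? (root? d)) QS)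

avoiding-unique : ∀ ds {S} → Unique S → Unique (avoiding ds S)
avoiding-unique []       uS = uS
avoiding-unique (d ∷ ds) uS = avoiding-unique ds (Unique.filter⁺ (∁? (root? d)) uS)

avoiding-avoids : ∀ ds S → All (NonVanishingAt ds) (avoiding ds S)
avoiding-avoids []       S = universal (λ _ → []) S
avoiding-avoids (d ∷ ds) S =
  zipWith (λ (d≢0 , ds≢0) → d≢0 ∷ ds≢0)
    (avoiding-⊆ ds (all-filter (∁? (root? d)) S) , avoiding-avoids ds _)

totalLength : List Poly → ℕ
totalLength []       = 0
totalLength (d ∷ ds) = length d +ℕ totalLength ds

-- Each nonzero d discards at most  length d  points (its roots), so at most
-- totalLength ds points are lost when avoiding the roots of all of ds.
avoiding-length : ∀ ds S → All (λ d → ¬ IsZeroP d) ds → Unique S →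
                  length S ≤ length (avoiding ds S) +ℕ totalLength ds
avoiding-length []       S []           _  = ≤-reflexive (sym (+ℕ-identityʳ _))
avoiding-length (d ∷ ds) S (d≢0 ∷ ds≢0) uS = begin
    length S
  ≡⟨ sym (length-filter-split (root? d) S) ⟩
    length (filter (root? d) S) +ℕ length S′
  ≤⟨ +-mono-≤ (roots-bound d S d≢0 uS)
              (avoiding-length ds S′ ds≢0 (Unique.filter⁺ (∁? (root? d)) uS)) ⟩
    length d +ℕ (length (avoiding ds S′) +ℕ totalLength ds)
  ≡⟨ x∙yz≈y∙xz (length d) (length (avoiding ds S′)) (totalLength ds) ⟩
    length (avoiding ds S′) +ℕ (length d +ℕ totalLength ds) ∎
  where
  open ≤-Reasoning
  S′ = filter (∁? (root? d)) S

point : ℕ → ℚ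
point k = fromℤ (ℤ.+ k)

samplePoints : ℕ → List ℚ
samplePoints N = map point (upTo N)

samplePoints-unique : ∀ N → Unique (samplePoints N)
samplePoints-unique N = Unique.map⁺ (λ e → +-injective (cong ↥_ e)) (Unique.upTo⁺ N)

samplePoints-length : ∀ N → length (samplePoints N) ≡ N
samplePoints-length N = trans (length-map point (upTo N)) (length-applyUpTo (λ k → k) N)

-- Of  length p + totalLength ds  sample points at
-- least  length p  avoid all roots of ds, and p vanishes at each of them.
identity-principle : ∀ p ds → All (λ d → ¬ IsZeroP d) ds →
                     (∀ t → NonVanishingAt ds t → eval p t ≡ 0ℚ) → IsZeroP p
identity-principle p ds ds≢0 vanish =
  vanishing-at-distinct-points p good (avoiding-unique ds (samplePoints-unique N)) enough
    (All-map (vanish _) (avoiding-avoids ds S))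
  where
  N = length p +ℕ totalLength ds
  S = samplePoints N
  good = avoiding ds S
  enough : length p ≤ length good
  enough = +-cancelʳ-≤ (totalLength ds) (length p) (length good)
             (≤-trans (≤-reflexive (sym (samplePoints-length N)))
                      (avoiding-length ds S ds≢0 (samplePoints-unique N)))

δ-scale : ∀ {n} (i k : Fin n) x → δ i k * x ≡ (if i ==F k then x else 0ℚ)
δ-scale i k x with i ==F k
... | true  = *-identityˡ x
... | false = *-zeroˡ x

scale-if : ∀ (b : Bool) c x → c * (if b then x else 0ℚ) ≡ (if b then c * x else 0ℚ)
scale-if true  c x = refl
scale-if false c x = *-zeroʳ c

module _ {n : ℕ} (Z M : Fin n → Fin n → ℚ) where

  right-inverse-weighting : (∀ i j → sum (λ k → Z i k * M k j) ≡ δ i j) →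
                            ∀ i → sum (λ y → Z i y * sum (M y)) ≡ 1ℚ
  right-inverse-weighting ZM≡I i = begin
      sum (λ y → Z i y * sum (M y))
    ≡⟨ sum-cong-≗ (λ y → *-distribˡ-sum (Z i y) (M y)) ⟩
      sum (λ y → sum (λ k → Z i y * M y k))
    ≡⟨ ∑-comm (λ y k → Z i y * M y k) ⟩
      sum (λ k → sum (λ y → Z i y * M y k))
    ≡⟨ sum-cong-≗ (ZM≡I i) ⟩
      sum (δ i)
    ≡⟨ sum-selectˡ i (λ _ → 1ℚ) ⟩
      1ℚ ∎
    where open ≡-Reasoning

  left-inverse-weighting : (∀ i j → sum (λ k → M i k * Z k j) ≡ δ i j) →
                           (v : Fin n → ℚ) → (∀ i → sum (λ j → Z i j * v j) ≡ 1ℚ) →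
                           ∀ i → sum (M i) ≡ v i
  left-inverse-weighting MZ≡I v Zv≡𝟙 i = begin
      sum (M i)
    ≡⟨ sum-cong-≗ (λ j → trans (sym (*-identityʳ (M i j))) (cong (M i j *_) (sym (Zv≡𝟙 j)))) ⟩
      sum (λ j → M i j * sum (λ k → Z j k * v k))
    ≡⟨ sum-cong-≗ {n} (λ j → trans (*-distribˡ-sum {n} (M i j) (λ k → Z j k * v k))
                                   (sum-cong-≗ {n} (λ k → sym (*-assoc (M i j) (Z j k) (v k))))) ⟩
      sum (λ j → sum (λ k → M i j * Z j k * v k))
    ≡⟨ ∑-comm (λ j k → M i j * Z j k * v k) ⟩
      sum (λ k → sum (λ j → M i j * Z j k * v k))
    ≡⟨ sum-cong-≗ (λ k → sym (*-distribʳ-sum (v k) (λ j → M i j * Z j k))) ⟩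
      sum (λ k → sum (λ j → M i j * Z j k) * v k)
    ≡⟨ sum-cong-≗ (λ k → trans (cong (_* v k) (MZ≡I i k)) (δ-scale i k (v k))) ⟩
      sum (λ k → if i ==F k then v k else 0ℚ)
    ≡⟨ sum-selectˡ i v ⟩
      v i ∎
    where open ≡-Reasoning

Zat : ∀ {n} → Graph n → ℚ → Fin n → Fin n → ℚ
Zat G t x y = qval t (dist G x y)

fibreSumAt : ∀ {m n} → Graph n → (Fin m → Fin n) → (Fin n → Fin m) →
             ℚ → (Fin n → ℚ) → Fin m → ℚ
fibreSumAt X ι π t w u =
  sum (λ x → if inXU X ι x ∧ (π x ==F u) then Zat X t (ι u) x * w x else 0ℚ)

module _ {m n : ℕ} {X : Graph n} {U : Graph m} {ι : Fin m → Fin n} {π : Fin n → Fin m}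
         (convex : IsConvex U X ι) (projects : IsProjection X ι π) (t : ℚ) (w : Fin n → ℚ) where

  -- The u-sum of the x-th terms: only u = π x contributes, and then
  -- t^{d_U(u',π x)} t^{d(π x, x)} = t^{d(u',x)}; vertices outside X_U contribute 0 on both sides.
  fibre-term : ∀ u' x →
    sum (λ u → if inXU X ι x ∧ (π x ==F u) then Zat U t u' u * (Zat X t (ι u) x * w x) else 0ℚ)
    ≡ Zat X t (ι u') x * w x
  fibre-term u' x with inXU X ι x in x∈?
  ... | true = begin
      sum (λ u → if π x ==F u then Zat U t u' u * (Zat X t (ι u) x * w x) else 0ℚ)
    ≡⟨ sum-selectˡ (π x) (λ u → Zat U t u' u * (Zat X t (ι u) x * w x)) ⟩
      Zat U t u' (π x) * (Zat X t (ι (π x)) x * w x)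
    ≡⟨ sym (*-assoc (Zat U t u' (π x)) _ (w x)) ⟩
      Zat U t u' (π x) * Zat X t (ι (π x)) x * w x
    ≡⟨ cong (_* w x) (sym (trans (cong (qval t) (projection-factorises convex projects u' x x∈XU))
                                 (qval-+∞ t (dist U u' (π x)) _))) ⟩
      Zat X t (ι u') x * w x ∎
    where open ≡-Reasoning
          x∈XU = subst T (sym x∈?) tt
  ... | false = begin
      sum {m} (λ _ → 0ℚ)        ≡⟨ sum-replicate-zero m ⟩
      0ℚ                        ≡⟨ sym (*-zeroˡ (w x)) ⟩
      0ℚ * w x                  ≡⟨ cong (λ d → qval t d * w x)
                                        (sym (outside-unreachable u' x x∈?)) ⟩
      Zat X t (ι u') x * w x    ∎
    where open ≡-Reasoning

  fibre-reassembly : ∀ u' → sum (λ u → Zat U t u' u * fibreSumAt X ι π t w u)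
                          ≡ sum (λ x → Zat X t (ι u') x * w x)
  fibre-reassembly u' = begin
      sum (λ u → Zat U t u' u * fibreSumAt X ι π t w u)
    ≡⟨ sum-cong-≗ {m} (λ u → trans (*-distribˡ-sum {n} (Zat U t u' u) _)
                                   (sum-cong-≗ {n} (λ x → scale-if (fibre x u) (Zat U t u' u) _))) ⟩
      sum (λ u → sum (λ x → if fibre x u then Zat U t u' u * (Zat X t (ι u) x * w x) else 0ℚ))
    ≡⟨ ∑-comm {m} {n} _ ⟩
      sum (λ x → sum (λ u → if fibre x u then Zat U t u' u * (Zat X t (ι u) x * w x) else 0ℚ))
    ≡⟨ sum-cong-≗ {n} (fibre-term u') ⟩
      sum (λ x → Zat X t (ι u') x * w x) ∎
    where
    open ≡-Reasoning
    fibre : Fin n → Fin m → Bool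
    fibre x u = inXU X ι x ∧ (π x ==F u)

weighting-via-fibres : ∀ {m n} {X : Graph n} {U : Graph m}
                         {ι : Fin m → Fin n} {π : Fin n → Fin m} →
  IsConvex U X ι → IsProjection X ι π →
  ∀ t (mX : Fin n → Fin n → ℚ) (mU : Fin m → Fin m → ℚ) →
  (∀ i j → sum (λ k → Zat X t i k * mX k j) ≡ δ i j) →
  (∀ i j → sum (λ k → mU i k * Zat U t k j) ≡ δ i j) →
  ∀ u → sum (mU u) ≡ fibreSumAt X ι π t (λ x → sum (mX x)) u
weighting-via-fibres {X = X} {U} {ι} {π} convex projects t mX mU right left =
  left-inverse-weighting (Zat U t) mU left (fibreSumAt X ι π t wX) λ u' →
    trans (fibre-reassembly convex projects t wX u')
          (right-inverse-weighting (Zat X t) mX right (ι u'))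
  where wX = λ x → sum (mX x)

denominators : ∀ {n} → Mat n → List Poly
denominators M = concat (tabulate (λ i → tabulate (λ j → proj₂ (M i j))))

denominators⁺ : ∀ {n} {P : Poly → Set} (M : Mat n) →
                (∀ i j → P (proj₂ (M i j))) → All P (denominators M)
denominators⁺ M P-M = concat⁺ (All-tabulate⁺ (λ i → All-tabulate⁺ (P-M i)))

denominators⁻ : ∀ {n} {P : Poly → Set} (M : Mat n) →
                All P (denominators M) → ∀ i j → P (proj₂ (M i j))
denominators⁻ M P-M i j = All-tabulate⁻ (All-tabulate⁻ (concat⁻ P-M) i) j

valueAt : ∀ {n} (M : Mat n) t → NonVanishingAt (denominators M) t → Fin n → Fin n → ℚ
valueAt M t defined i j = proj₁ (value-exists (M i j) t (denominators⁻ M defined i j))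

value-valueAt : ∀ {n} (M : Mat n) t (defined : NonVanishingAt (denominators M) t) →
                ∀ i j → Value t (M i j) (valueAt M t defined i j)
value-valueAt M t defined i j = proj₂ (value-exists (M i j) t (denominators⁻ M defined i j))

product-at : ∀ {n t} (A B : Mat n) {a b : Fin n → Fin n → ℚ} →
             (∀ i j → Value t (A i j) (a i j)) → (∀ i j → Value t (B i j) (b i j)) →
             (∀ i j → (A ·M B) i j ≈F idM i j) → ∀ i j → sum (λ k → a i k * b k j) ≡ δ i j
product-at {n} {t} A B A≔a B≔b AB≈I i j =
  value-unique (value-≈F (value-sumF n (λ k → value-*F (A≔a i k) (B≔b k j))) (AB≈I i j)
                         (Value.den≢0 (value-idM t i j)))
               (value-idM t i j)

lemma4p8-at-point : ∀ {m n} (X : Graph n) (U : Graph m) (ι : Fin m → Fin n)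
  (π : Fin n → Fin m) (MX : Mat n) (MU : Mat m) →
  IsConvex U X ι → IsProjection X ι π →
  IsInverse MX (Zmat X) → IsInverse MU (Zmat U) →
  ∀ u t → NonVanishingAt (denominators MX ++ denominators MU) t →
  eval (crossDiff (weighting MU u) (fiberSum X ι π (weighting MX) u)) t ≡ 0ℚ
lemma4p8-at-point {m} {n} X U ι π MX MU convex projects
                  (_ , _ , ZX·MX≈I) (_ , MU·ZU≈I , _) u t defined =
  value-crossDiff (subst (Value t (weighting MU u)) weightings-agree (value-sumF m (MU≔mU u)))
                  fiberSum-value
  where
  definedX = ++⁻ˡ (denominators MX) defined
  definedU = ++⁻ʳ (denominators MX) defined
  mX = valueAt MX t definedX
  mU = valueAt MU t definedU
  MX≔mX = value-valueAt MX t definedX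
  MU≔mU = value-valueAt MU t definedU

  weightings-agree : sum (mU u) ≡ fibreSumAt X ι π t (λ x → sum (mX x)) u
  weightings-agree = weighting-via-fibres convex projects t mX mU
    (product-at (Zmat X) MX (λ i j → value-qpow t (dist X i j)) MX≔mX ZX·MX≈I)
    (product-at MU (Zmat U) MU≔mU (λ i j → value-qpow t (dist U i j)) MU·ZU≈I)
    u

  fiberSum-value : Value t (fiberSum X ι π (weighting MX) u)
                           (fibreSumAt X ι π t (λ x → sum (mX x)) u)
  fiberSum-value = value-sumF n λ x → value-if (inXU X ι x ∧ (π x ==F u))
    (value-*F (value-qpow t (dist X (ι u) x)) (value-sumF n (MX≔mX x)))

-- Lemma 4.8: both sides are rational functions defined wherever the denominators of
-- the two inverse matrices are nonzero, and they agree at every such point; by the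
-- identity principle their cross-multiplied difference is the zero polynomial.
lemma4p8 : {m n : ℕ} (X : Graph n) (U : Graph m) (ι : Fin m → Fin n)
           (π : Fin n → Fin m) (MX : Mat n) (MU : Mat m) →
           IsConvex U X ι → IsProjection X ι π →
           IsInverse MX (Zmat X) → IsInverse MU (Zmat U) →
           ∀ u → weighting MU u ≈F fiberSum X ι π (weighting MX) u
lemma4p8 X U ι π MX MU convex projects invX invU u =
  identity-principle (crossDiff (weighting MU u) (fiberSum X ι π (weighting MX) u))
    (denominators MX ++ denominators MU)
    (++⁺ (denominators⁺ MX (proj₁ invX)) (denominators⁺ MU (proj₁ invU)))
    (lemma4p8-at-point X U ι π MX MU convex projects invX invU u)
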